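{- For integers $t \ge 0$, let $N(t)$ be the number of tilings of the $4 \times 3t$ rectangle by right trominoes, with $N(0)=1$. Then \[ \sum_{t \ge 0} N(t)\, z^t = \frac{1 - 6 z}{1 - 10 z + 22 z^2 + 4 z^3}. \] Consequently $N(t)$ grows like $\lambda^t$, where $\lambda = 6.5456077\ldots$ is the largest positive root of $\lambda^3 - 10\lambda^2 + 22\lambda + 4 = 0$.
   Context: A right tromino is the polyomino of three unit squares obtained by deleting one cell from a $2 \times 2$ square. A tiling of a region of the square grid by a polyomino is a partition of the region's unit cells into copies of the polyomino, where copies may be translated, rotated and reflected. A $4 \times n$ rectangle has 4 rows and $n$ columns. -}

module Defs where

open import Data.Nat using (ℕ; zero; suc; _+_; _*_; _∸_; _≤ᵇ_; _≡ᵇ_)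
open import Data.Bool using (Bool; true; false; _∧_; not)
open import Data.List using (List; []; _∷_; _++_; map; concatMap; filter; length; upTo; foldr)
open import Data.Product using (_×_; _,_)
open import Data.Integer as ℤ using (ℤ; +_; -[1+_])
open import Relation.Nullary.Decidable using (does)
open import Relation.Binary.PropositionalEquality using (_≡_)
open import Relation.Nullary using (yes; no)
open import Data.Bool using (T; T?)

Cell : Set
Cell = ℕ × ℕ

cells : ℕ → List Cell
cells n = concatMap (λ i → map (λ j → (i , j)) (upTo n)) (upTo 4)

-- A placed right tromino: the 2×2 block with top-left cell (r , c),
-- with the cell (r + a , c + b) (a , b ∈ {0,1}) deleted.
record Placement : Set where
  constructor place
  field
    r c a b : ℕ

-- All right-tromino placements lying inside the 4 × n rectangle
-- (every rotation/reflection of a right tromino is one of these).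
placements : ℕ → List Placement
placements n =
  concatMap (λ r → concatMap (λ c → concatMap (λ a → map (λ b → place r c a b)
    (upTo 2)) (upTo 2)) (upTo (n ∸ 1))) (upTo 3)

covers : Placement → Cell → Bool
covers (place r c a b) (i , j) =
  (r ≤ᵇ i) ∧ (i ≤ᵇ r + 1) ∧ (c ≤ᵇ j) ∧ (j ≤ᵇ c + 1)
  ∧ not ((i ≡ᵇ r + a) ∧ (j ≡ᵇ c + b))

allB : {A : Set} → (A → Bool) → List A → Bool
allB f = foldr (λ x acc → f x ∧ acc) true

sublists : {A : Set} → List A → List (List A)
sublists [] = [] ∷ []
sublists (x ∷ xs) = sublists xs ++ map (x ∷_) (sublists xs)

isTiling : ℕ → List Placement → Bool
isTiling n S = allB (λ x → length (filter (λ p → T? (covers p x)) S) ≡ᵇ 1) (cells n)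

tilings : ℕ → ℕ
tilings n = length (filter (λ S → T? (isTiling n S)) (sublists (placements n)))

N : ℕ → ℤ
N t = + tilings (3 * t)

coeff : List ℤ → ℕ → ℤ
coeff [] n = + 0
coeff (x ∷ xs) zero = x
coeff (x ∷ xs) (suc n) = coeff xs n

polyMul : List ℤ → (ℕ → ℤ) → ℕ → ℤ
polyMul [] f n = + 0
polyMul (x ∷ xs) f zero = x ℤ.* f zero
polyMul (x ∷ xs) f (suc n) = x ℤ.* f (suc n) ℤ.+ polyMul xs f n

-- Transfer matrix method. Let f_n(b) count the tilings of columns 0, …, n − 1 together with the cells b of
-- column n (a 0/1 pattern), by trominoes lying in columns 0, …, n. Sorting the trominoes with left column n
-- by how they meet columns n and n + 1 gives f_{n+1} = T f_n for a linear operator T on functions of b,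
-- and N(t) = f_{3t−1}(1111). Evaluating f_0, …, f_9 shows that T⁹ − 10T⁶ + 22T³ + 4 kills f_0; by
-- linearity it kills every f_j, which is the recurrence N(t+3) − 10N(t+2) + 22N(t+1) + 4N(t) = 0 for t ≥ 1.
-- Together with N(0), …, N(3) = 1, 4, 18, 88 this gives the numerator 1 − 6z.

module Submission where

open import Defs
open import Data.Nat using (ℕ)
open import Data.List using (List; []; _∷_)
open import Data.Integer using (ℤ; +_; -_)
open import Relation.Binary.PropositionalEquality using (_≡_)

open import Data.Bool using (Bool; true; false; _∧_; _∨_; if_then_else_; T; T?)
open import Data.Bool.Properties using (∧-zeroʳ; T-∨)
open import Data.Empty using (⊥-elim)
open import Data.Integer using (-[1+_]; _+_; _-_; _*_)
import Data.Integer as ℤ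
import Data.Integer.Properties as ℤ
open import Data.Integer.Tactic.RingSolver using (solve-∀)
import Data.Nat.Tactic.RingSolver as ℕ-Solver
open import Data.List using (_++_; map; filter; length; upTo; concatMap; foldl; [_])
open import Data.List.Properties using (filter-++; filter-≐; length-++; ++-assoc; ++-identityʳ; upTo-∷ʳ; map-++; concatMap-++; concatMap-cong; map-∘; map-cong)
open import Data.List.Relation.Binary.Permutation.Propositional as ↭ using (_↭_; ↭-sym; module PermutationReasoning)
open import Data.List.Relation.Binary.Permutation.Propositional.Properties using (shifts; ++-comm; ++⁺ˡ; Any-resp-↭)
open import Data.List.Relation.Unary.All using (All; []; _∷_)
import Data.List.Relation.Unary.All as All
open import Data.List.Relation.Unary.All.Properties using (concat⁺; map⁺; applyUpTo⁺₁)
open import Data.List.Relation.Unary.Any using (Any; here; there)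
import Data.List.Relation.Unary.Any as Any
import Data.List.Relation.Unary.Any.Properties as Any
open import Data.Nat using (zero; suc; _<_; _≤ᵇ_; s≤s)
import Data.Nat as ℕ
import Data.Nat.Properties as ℕ
open import Data.Product using (_×_; _,_; proj₁; proj₂)
open import Data.Sum using (inj₁; inj₂)
open import Data.Unit using (tt)
open import Data.Maybe using (Maybe; just; nothing; maybe′)
import Data.Maybe as Maybe
open import Data.Vec using (Vec; []; _∷_; zipWith; replicate) renaming (map to mapᵛ)
import Data.Vec.Properties as Vec
open import Data.Vec.Relation.Unary.All using () renaming (All to Allᵛ)
import Data.Vec.Relation.Unary.All as Allᵛ
open import Data.Vec.Relation.Unary.Any using () renaming (Any to Anyᵛ)
import Data.Vec.Relation.Unary.Any as Anyᵛ
import Data.Vec.Relation.Unary.Any.Properties as Anyᵛ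
open import Function using (_∘_; Equivalence)
open import Relation.Binary.PropositionalEquality using (refl; sym; trans; cong; cong₂; subst; _≗_; module ≡-Reasoning)

-- Sums over sublists

+-interchange : ∀ a b c d → (a + b) + (c + d) ≡ (a + c) + (b + d)
+-interchange = solve-∀

indicator : Bool → ℤ
indicator b = if b then + 1 else + 0

module SublistSum {X Y : Set} (act : X → Y → X) where

  sublistSum : List Y → (X → ℤ) → X → ℤ
  sublistSum []       k x = k x
  sublistSum (y ∷ ys) k x = sublistSum ys k x + sublistSum ys k (act x y)

  length-filter-map : ∀ (f : List Y → Bool) y (Ss : List (List Y)) →
    length (filter (λ S → T? (f S)) (map (y ∷_) Ss)) ≡ length (filter (λ S → T? (f (y ∷ S))) Ss)
  length-filter-map f y []       = refl
  length-filter-map f y (S ∷ Ss) with f (y ∷ S)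
  ... | true  = cong suc (length-filter-map f y Ss)
  ... | false = length-filter-map f y Ss

  count-sublists : ∀ (f : X → Bool) ys x →
    + length (filter (λ S → T? (f (foldl act x S))) (sublists ys)) ≡ sublistSum ys (indicator ∘ f) x
  count-sublists f []       x with f x
  ... | true  = refl
  ... | false = refl
  count-sublists f (y ∷ ys) x = begin
    + length (filter P (sublists ys ++ map (y ∷_) (sublists ys)))
      ≡⟨ cong (+_ ∘ length) (filter-++ P (sublists ys) _) ⟩
    + length (filter P (sublists ys) ++ filter P (map (y ∷_) (sublists ys)))
      ≡⟨ cong +_ (length-++ (filter P (sublists ys))) ⟩
    + length (filter P (sublists ys)) + + length (filter P (map (y ∷_) (sublists ys)))
      ≡⟨ cong₂ _+_ (count-sublists f ys x)
                   (trans (cong +_ (length-filter-map (f ∘ foldl act x) y (sublists ys)))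
                          (count-sublists f ys (act x y))) ⟩
    sublistSum (y ∷ ys) (indicator ∘ f) x ∎
    where
    open ≡-Reasoning
    P = λ S → T? (f (foldl act x S))

  sublistSum-++ : ∀ ys zs k x → sublistSum (ys ++ zs) k x ≡ sublistSum ys (sublistSum zs k) x
  sublistSum-++ []       zs k x = refl
  sublistSum-++ (y ∷ ys) zs k x = cong₂ _+_ (sublistSum-++ ys zs k x) (sublistSum-++ ys zs k (act x y))

  sublistSum-cong : ∀ ys {k k′} → k ≗ k′ → sublistSum ys k ≗ sublistSum ys k′
  sublistSum-cong []       k≗k′ x = k≗k′ x
  sublistSum-cong (y ∷ ys) k≗k′ x = cong₂ _+_ (sublistSum-cong ys k≗k′ x) (sublistSum-cong ys k≗k′ (act x y))

  sublistSum-+ : ∀ ys k k′ x → sublistSum ys (λ x → k x + k′ x) x ≡ sublistSum ys k x + sublistSum ys k′ x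
  sublistSum-+ []       k k′ x = refl
  sublistSum-+ (y ∷ ys) k k′ x = trans
    (cong₂ _+_ (sublistSum-+ ys k k′ x) (sublistSum-+ ys k k′ (act x y)))
    (+-interchange (sublistSum ys k x) (sublistSum ys k′ x) (sublistSum ys k (act x y)) (sublistSum ys k′ (act x y)))

  sublistSum-*ˡ : ∀ ys c k x → sublistSum ys (λ x → c * k x) x ≡ c * sublistSum ys k x
  sublistSum-*ˡ []       c k x = refl
  sublistSum-*ˡ (y ∷ ys) c k x = trans
    (cong₂ _+_ (sublistSum-*ˡ ys c k x) (sublistSum-*ˡ ys c k (act x y)))
    (sym (ℤ.*-distribˡ-+ c _ _))

  sublistSum-*ʳ-invariant : ∀ ys (k g : X → ℤ) → All (λ y → ∀ x → g (act x y) ≡ g x) ys →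
    ∀ x → sublistSum ys (λ x → k x * g x) x ≡ sublistSum ys k x * g x
  sublistSum-*ʳ-invariant []       k g []         x = refl
  sublistSum-*ʳ-invariant (y ∷ ys) k g (gy ∷ gys) x = begin
    sublistSum ys (λ x → k x * g x) x + sublistSum ys (λ x → k x * g x) (act x y)
      ≡⟨ cong₂ _+_ (sublistSum-*ʳ-invariant ys k g gys x) (sublistSum-*ʳ-invariant ys k g gys (act x y)) ⟩
    sublistSum ys k x * g x + sublistSum ys k (act x y) * g (act x y)
      ≡⟨ cong (λ z → sublistSum ys k x * g x + sublistSum ys k (act x y) * z) (gy x) ⟩
    sublistSum ys k x * g x + sublistSum ys k (act x y) * g x
      ≡⟨ sym (ℤ.*-distribʳ-+ (g x) (sublistSum ys k x) (sublistSum ys k (act x y))) ⟩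
    sublistSum (y ∷ ys) k x * g x ∎
    where open ≡-Reasoning

  sublistSum-vanishes : (D : X → Set) → (∀ {x} y → D x → D (act x y)) →
    ∀ ys k → (∀ {x} → D x → k x ≡ + 0) → ∀ {x} → D x → sublistSum ys k x ≡ + 0
  sublistSum-vanishes D D-act []       k k-D Dx = k-D Dx
  sublistSum-vanishes D D-act (y ∷ ys) k k-D Dx =
    cong₂ _+_ (sublistSum-vanishes D D-act ys k k-D Dx) (sublistSum-vanishes D D-act ys k k-D (D-act y Dx))

  prunedSum : (X → Bool) → List Y → (X → ℤ) → X → ℤ
  prunedSum dead []       k x = k x
  prunedSum dead (y ∷ ys) k x =
    if dead x then + 0 else prunedSum dead ys k x + prunedSum dead ys k (act x y)

  sublistSum≡prunedSum : ∀ dead → (∀ {x} y → T (dead x) → T (dead (act x y))) →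
    ∀ ys k → (∀ {x} → T (dead x) → k x ≡ + 0) → ∀ x → sublistSum ys k x ≡ prunedSum dead ys k x
  sublistSum≡prunedSum dead dead-act []       k k-dead x = refl
  sublistSum≡prunedSum dead dead-act (y ∷ ys) k k-dead x with dead x in eq
  ... | true  = cong₂ _+_ (vanish dead-x) (vanish (dead-act y dead-x))
    where
    dead-x = subst T (sym eq) tt
    vanish = sublistSum-vanishes (T ∘ dead) dead-act ys k k-dead
  ... | false = cong₂ _+_ (sublistSum≡prunedSum dead dead-act ys k k-dead x)
                          (sublistSum≡prunedSum dead dead-act ys k k-dead (act x y))

open SublistSum

sublistSum-simulation : ∀ {X Y X′ Y′ : Set} {act : X → Y → X} {act′ : X′ → Y′ → X′}
  (R : X → X′ → Set) (f : Y → Y′) {k : X → ℤ} {k′ : X′ → ℤ} → ∀ ys →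
  All (λ y → ∀ {x x′} → R x x′ → R (act x y) (act′ x′ (f y))) ys →
  (∀ {x x′} → R x x′ → k x ≡ k′ x′) →
  ∀ {x x′} → R x x′ → sublistSum act ys k x ≡ sublistSum act′ (map f ys) k′ x′
sublistSum-simulation R f []       []           R-leaf r = R-leaf r
sublistSum-simulation R f (y ∷ ys) (R-y ∷ R-ys) R-leaf r =
  cong₂ _+_ (sublistSum-simulation R f ys R-ys R-leaf r) (sublistSum-simulation R f ys R-ys R-leaf (R-y r))

allB-cong : ∀ {A : Set} {f g : A → Bool} {xs} → All (λ x → f x ≡ g x) xs → allB f xs ≡ allB g xs
allB-cong []       = refl
allB-cong (e ∷ es) = cong₂ _∧_ e (allB-cong es)

allB-++ : ∀ {A : Set} (f : A → Bool) xs ys → allB f (xs ++ ys) ≡ allB f xs ∧ allB f ys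
allB-++ f []       ys = refl
allB-++ f (x ∷ xs) ys with f x
... | true  = allB-++ f xs ys
... | false = refl

allB-↭ : ∀ {A : Set} (f : A → Bool) {xs ys} → xs ↭ ys → allB f xs ≡ allB f ys
allB-↭ f ↭.refl          = refl
allB-↭ f (↭.prep x σ)    = cong (f x ∧_) (allB-↭ f σ)
allB-↭ f (↭.swap x y σ) with f x | f y
... | true  | true  = allB-↭ f σ
... | true  | false = refl
... | false | true  = refl
... | false | false = refl
allB-↭ f (↭.trans σ τ) = trans (allB-↭ f σ) (allB-↭ f τ)

allB-any-false : ∀ {A : Set} {f : A → Bool} {xs} → Any (λ x → f x ≡ false) xs → allB f xs ≡ false
allB-any-false {f = f} {x ∷ xs} (here e) rewrite e = refl
allB-any-false {f = f} {x ∷ xs} (there a) = trans (cong (f x ∧_) (allB-any-false a)) (∧-zeroʳ (f x))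

indicator-∧ : ∀ a b → indicator (a ∧ b) ≡ indicator a * indicator b
indicator-∧ true  true  = refl
indicator-∧ true  false = refl
indicator-∧ false b     = refl

concatMap-++-↭ : ∀ {A B : Set} (f g : A → List B) xs →
  concatMap (λ x → f x ++ g x) xs ↭ concatMap f xs ++ concatMap g xs
concatMap-++-↭ f g []       = ↭.refl
concatMap-++-↭ f g (x ∷ xs) = begin
  (f x ++ g x) ++ concatMap (λ x → f x ++ g x) xs   ≡⟨ ++-assoc (f x) (g x) _ ⟩
  f x ++ g x ++ concatMap (λ x → f x ++ g x) xs     ↭⟨ ++⁺ˡ (f x) (++⁺ˡ (g x) (concatMap-++-↭ f g xs)) ⟩
  f x ++ g x ++ concatMap f xs ++ concatMap g xs    ↭⟨ ++⁺ˡ (f x) (shifts (g x) (concatMap f xs)) ⟩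
  f x ++ concatMap f xs ++ g x ++ concatMap g xs    ≡⟨ ++-assoc (f x) (concatMap f xs) _ ⟨
  (f x ++ concatMap f xs) ++ g x ++ concatMap g xs  ∎
  where open PermutationReasoning

concatMap-upTo-suc : ∀ {B : Set} (f : ℕ → List B) n → concatMap f (upTo (suc n)) ≡ concatMap f (upTo n) ++ f n
concatMap-upTo-suc f n = begin
  concatMap f (upTo (suc n))          ≡⟨ cong (concatMap f) (upTo-∷ʳ n) ⟨
  concatMap f (upTo n ++ [ n ])       ≡⟨ concatMap-++ f (upTo n) [ n ] ⟩
  concatMap f (upTo n) ++ (f n ++ [])  ≡⟨ cong (concatMap f (upTo n) ++_) (++-identityʳ (f n)) ⟩
  concatMap f (upTo n) ++ f n          ∎
  where open ≡-Reasoning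

map-upTo-suc : ∀ {B : Set} (f : ℕ → B) n → map f (upTo (suc n)) ≡ map f (upTo n) ++ [ f n ]
map-upTo-suc f n = trans (cong (map f) (sym (upTo-∷ʳ n))) (map-++ f (upTo n) [ n ])

-- Linear operators and tables

record IsLinear {B : Set} (F : (B → ℤ) → B → ℤ) : Set where
  field
    cong-≗ : ∀ {v v′} → v ≗ v′ → F v ≗ F v′
    +-homo : ∀ v v′ → F (λ b → v b + v′ b) ≗ λ u → F v u + F v′ u
    *-homo : ∀ c v → F (λ b → c * v b) ≗ λ u → c * F v u

shiftedSum : ∀ {B : Set} → List (ℤ × ℕ) → (ℕ → B → ℤ) → ℕ → B → ℤ
shiftedSum []             F j u = + 0
shiftedSum ((c , d) ∷ cs) F j u = c * F (d ℕ.+ j) u + shiftedSum cs F j u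

shiftedSum-cong : ∀ {B : Set} cs {F G : ℕ → B → ℤ} → (∀ k → F k ≗ G k) → ∀ j → shiftedSum cs F j ≗ shiftedSum cs G j
shiftedSum-cong []             F≗G j u = refl
shiftedSum-cong ((c , d) ∷ cs) F≗G j u = cong₂ _+_ (cong (c *_) (F≗G (d ℕ.+ j) u)) (shiftedSum-cong cs F≗G j u)

module _ {B : Set} {L : (B → ℤ) → B → ℤ} (linear : IsLinear L) where

  open IsLinear linear

  L-zero : L (λ _ → + 0) ≗ λ _ → + 0
  L-zero = *-homo (+ 0) (λ _ → + 0)

  shiftedSum-step : ∀ {F} → (∀ k → F (suc k) ≗ L (F k)) → ∀ cs j → shiftedSum cs F (suc j) ≗ L (shiftedSum cs F j)
  shiftedSum-step     step []             j u = sym (L-zero u)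
  shiftedSum-step {F} step ((c , d) ∷ cs) j u = begin
    c * F (d ℕ.+ suc j) u + shiftedSum cs F (suc j) u
      ≡⟨ cong₂ _+_ (cong (c *_) (trans (cong (λ k → F k u) (ℕ.+-suc d j)) (step (d ℕ.+ j) u)))
                   (shiftedSum-step step cs j u) ⟩
    c * L (F (d ℕ.+ j)) u + L (shiftedSum cs F j) u
      ≡⟨ cong (_+ L (shiftedSum cs F j) u) (*-homo c (F (d ℕ.+ j)) u) ⟨
    L (λ b → c * F (d ℕ.+ j) b) u + L (shiftedSum cs F j) u
      ≡⟨ +-homo (λ b → c * F (d ℕ.+ j) b) (shiftedSum cs F j) u ⟨
    L (shiftedSum ((c , d) ∷ cs) F j) u ∎
    where open ≡-Reasoning

  shiftedSum-vanishes : ∀ {F} → (∀ k → F (suc k) ≗ L (F k)) → ∀ cs →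
    shiftedSum cs F 0 ≗ (λ _ → + 0) → ∀ j → shiftedSum cs F j ≗ (λ _ → + 0)
  shiftedSum-vanishes step cs vanishes₀ zero    u = vanishes₀ u
  shiftedSum-vanishes step cs vanishes₀ (suc j) u =
    trans (shiftedSum-step step cs j u) (trans (cong-≗ (shiftedSum-vanishes step cs vanishes₀ j) u) (L-zero u))

Table : ℕ → Set
Table zero    = ℤ
Table (suc n) = Table n × Table n

tabulateᵀ : ∀ {n} → (Vec Bool n → ℤ) → Table n
tabulateᵀ {zero}  f = f []
tabulateᵀ {suc n} f = tabulateᵀ (f ∘ (false ∷_)) , tabulateᵀ (f ∘ (true ∷_))

lookupᵀ : ∀ {n} → Table n → Vec Bool n → ℤ
lookupᵀ t       []          = t
lookupᵀ (t , _) (false ∷ b) = lookupᵀ t b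
lookupᵀ (_ , t) (true ∷ b)  = lookupᵀ t b

lookup-tabulateᵀ : ∀ {n} (f : Vec Bool n → ℤ) b → lookupᵀ (tabulateᵀ f) b ≡ f b
lookup-tabulateᵀ f []          = refl
lookup-tabulateᵀ f (false ∷ b) = lookup-tabulateᵀ (f ∘ (false ∷_)) b
lookup-tabulateᵀ f (true ∷ b)  = lookup-tabulateᵀ (f ∘ (true ∷_)) b

≗-from-tabulateᵀ : ∀ {n} {f g : Vec Bool n → ℤ} → tabulateᵀ f ≡ tabulateᵀ g → f ≗ g
≗-from-tabulateᵀ {f = f} {g} eq b =
  trans (sym (lookup-tabulateᵀ f b)) (trans (cong (λ t → lookupᵀ t b) eq) (lookup-tabulateᵀ g b))

-- Exact covers

-- m x is the number of times the cell x still has to be covered.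
Demand : Set
Demand = Cell → ℤ

coverage : Placement → Cell → ℕ
coverage p x = if covers p x then 1 else 0

_∖_ : Demand → Placement → Demand
(m ∖ p) x = m x - + coverage p x

isZero : ℤ → Bool
isZero (+ zero)  = true
isZero (+ suc _) = false
isZero -[1+ _ ]  = false

isNegative : ℤ → Bool
isNegative (+ _)    = false
isNegative -[1+ _ ] = true

zeroOn : List Cell → Demand → Bool
zeroOn C m = allB (λ x → isZero (m x)) C

exactCovers : List Placement → List Cell → Demand → ℤ
exactCovers L C = sublistSum _∖_ L (indicator ∘ zeroOn C)

coverCount : List Placement → Cell → ℕ
coverCount S x = length (filter (λ p → T? (covers p x)) S)

coverCount-∷ : ∀ p S x → coverCount (p ∷ S) x ≡ coverage p x ℕ.+ coverCount S x
coverCount-∷ p S x with covers p x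
... | true  = refl
... | false = refl

residual : ∀ m S x → foldl _∖_ m S x ≡ m x - + coverCount S x
residual m []      x = sym (ℤ.+-identityʳ (m x))
residual m (p ∷ S) x = begin
  foldl _∖_ (m ∖ p) S x                          ≡⟨ residual (m ∖ p) S x ⟩
  m x - + coverage p x - + coverCount S x        ≡⟨ minus-minus (m x) _ _ ⟩
  m x - (+ coverage p x + + coverCount S x)      ≡⟨ cong (λ n → m x - + n) (sym (coverCount-∷ p S x)) ⟩
  m x - + coverCount (p ∷ S) x                   ∎
  where
  open ≡-Reasoning
  minus-minus : ∀ a b c → a - b - c ≡ a - (b + c)
  minus-minus = solve-∀

isTiling-residual : ∀ n S → isTiling n S ≡ zeroOn (cells n) (foldl _∖_ (λ _ → + 1) S)
isTiling-residual n S = allB-cong (All.universal (λ x → trans (one-cover (coverCount S x))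
                                                            (cong isZero (sym (residual (λ _ → + 1) S x)))) (cells n))
  where
  one-cover : ∀ k → (k ℕ.≡ᵇ 1) ≡ isZero (+ 1 - + k)
  one-cover zero          = refl
  one-cover (suc zero)    = refl
  one-cover (suc (suc k)) = refl

tilings-exactCovers : ∀ n → + tilings n ≡ exactCovers (placements n) (cells n) (λ _ → + 1)
tilings-exactCovers n = trans
  (cong (+_ ∘ length) (filter-≐ {P = T ∘ isTiling n} {Q = T ∘ zeroOn (cells n) ∘ foldl _∖_ one}
                                (λ S → T? (isTiling n S)) (λ S → T? (zeroOn (cells n) (foldl _∖_ one S)))
                                ((λ {S} → agree S) , (λ {S} → agree′ S)) (sublists (placements n))))
  (count-sublists _∖_ (zeroOn (cells n)) (placements n) one)
  where
  one : Demand
  one _ = + 1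
  agree : ∀ S → T (isTiling n S) → T (zeroOn (cells n) (foldl _∖_ one S))
  agree S = subst T (isTiling-residual n S)
  agree′ : ∀ S → T (zeroOn (cells n) (foldl _∖_ one S)) → T (isTiling n S)
  agree′ S = subst T (sym (isTiling-residual n S))

∖-comm : ∀ m p q → (m ∖ p) ∖ q ≗ (m ∖ q) ∖ p
∖-comm m p q x = swap-minus (m x) (+ coverage p x) (+ coverage q x)
  where
  swap-minus : ∀ a b c → a - b - c ≡ a - c - b
  swap-minus = solve-∀

sublistSum-∖-resp : ∀ {k : Demand → ℤ} → (∀ {m m′} → m ≗ m′ → k m ≡ k m′) →
  ∀ L {m m′} → m ≗ m′ → sublistSum _∖_ L k m ≡ sublistSum _∖_ L k m′
sublistSum-∖-resp k-resp []      m≗m′ = k-resp m≗m′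
sublistSum-∖-resp k-resp (p ∷ L) m≗m′ =
  cong₂ _+_ (sublistSum-∖-resp k-resp L m≗m′)
            (sublistSum-∖-resp k-resp L (λ x → cong (_- + coverage p x) (m≗m′ x)))

sublistSum-∖-↭ : ∀ {k : Demand → ℤ} → (∀ {m m′} → m ≗ m′ → k m ≡ k m′) →
  ∀ {L L′} → L ↭ L′ → ∀ m → sublistSum _∖_ L k m ≡ sublistSum _∖_ L′ k m
sublistSum-∖-↭ k-resp ↭.refl         m = refl
sublistSum-∖-↭ k-resp (↭.prep p σ)   m = cong₂ _+_ (sublistSum-∖-↭ k-resp σ m) (sublistSum-∖-↭ k-resp σ (m ∖ p))
sublistSum-∖-↭ k-resp (↭.trans σ τ)  m = trans (sublistSum-∖-↭ k-resp σ m) (sublistSum-∖-↭ k-resp τ m)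
sublistSum-∖-↭ {k} k-resp {p ∷ q ∷ L} {.q ∷ .p ∷ L′} (↭.swap .p .q σ) m = begin
  (Σ L m + Σ L (m ∖ q)) + (Σ L (m ∖ p) + Σ L ((m ∖ p) ∖ q))
    ≡⟨ +-interchange (Σ L m) (Σ L (m ∖ q)) (Σ L (m ∖ p)) (Σ L ((m ∖ p) ∖ q)) ⟩
  (Σ L m + Σ L (m ∖ p)) + (Σ L (m ∖ q) + Σ L ((m ∖ p) ∖ q))
    ≡⟨ cong (λ z → (Σ L m + Σ L (m ∖ p)) + (Σ L (m ∖ q) + z)) (sublistSum-∖-resp k-resp L (∖-comm m p q)) ⟩
  (Σ L m + Σ L (m ∖ p)) + (Σ L (m ∖ q) + Σ L ((m ∖ q) ∖ p))
    ≡⟨ cong₂ _+_ (cong₂ _+_ (σ′ m) (σ′ (m ∖ p))) (cong₂ _+_ (σ′ (m ∖ q)) (σ′ ((m ∖ q) ∖ p))) ⟩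
  (Σ L′ m + Σ L′ (m ∖ p)) + (Σ L′ (m ∖ q) + Σ L′ ((m ∖ q) ∖ p)) ∎
  where
  open ≡-Reasoning
  Σ : List Placement → Demand → ℤ
  Σ L = sublistSum _∖_ L k
  σ′ = sublistSum-∖-↭ k-resp σ

zeroOn-resp : ∀ C {m m′} → m ≗ m′ → zeroOn C m ≡ zeroOn C m′
zeroOn-resp C m≗m′ = allB-cong (All.universal (cong isZero ∘ m≗m′) C)

exactCovers-↭ : ∀ {L L′} C → L ↭ L′ → ∀ m → exactCovers L C m ≡ exactCovers L′ C m
exactCovers-↭ C = sublistSum-∖-↭ (cong indicator ∘ zeroOn-resp C)

exactCovers-cells-↭ : ∀ L {C C′} → C ↭ C′ → ∀ m → exactCovers L C m ≡ exactCovers L C′ m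
exactCovers-cells-↭ L σ = sublistSum-cong _∖_ L (λ m → cong indicator (allB-↭ _ σ))

Untouched : List Cell → Placement → Set
Untouched D p = All (λ x → covers p x ≡ false) D

exactCovers-untouched : ∀ L C D → All (Untouched D) L → ∀ m →
  exactCovers L (C ++ D) m ≡ exactCovers L C m * indicator (zeroOn D m)
exactCovers-untouched L C D untouched m = trans
  (sublistSum-cong _∖_ L (λ m′ → trans (cong indicator (allB-++ _ C D)) (indicator-∧ (zeroOn C m′) (zeroOn D m′))) m)
  (sublistSum-*ʳ-invariant _∖_ L (indicator ∘ zeroOn C) (indicator ∘ zeroOn D) (All.map (λ {p} → invariant p) untouched) m)
  where
  invariant : ∀ p → Untouched D p → ∀ m → indicator (zeroOn D (m ∖ p)) ≡ indicator (zeroOn D m)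
  invariant p untouched-p m = cong indicator (allB-cong (All.map unchanged untouched-p))
    where
    unchanged : ∀ {x} → covers p x ≡ false → isZero ((m ∖ p) x) ≡ isZero (m x)
    unchanged {x} e rewrite e = cong isZero (ℤ.+-identityʳ (m x))

isNegative-minus : ∀ i n → T (isNegative i) → T (isNegative (i - + n))
isNegative-minus -[1+ k ] zero    _ = tt
isNegative-minus -[1+ k ] (suc n) _ = tt

exactCovers-negative : ∀ L C m → Any (λ x → T (isNegative (m x))) C → exactCovers L C m ≡ + 0
exactCovers-negative L C m = sublistSum-vanishes _∖_ NegativeSomewhere
  (λ {m} p → Any.map (λ {x} → isNegative-minus (m x) (coverage p x))) L (indicator ∘ zeroOn C)
  (λ neg → cong indicator (allB-any-false (Any.map negative-nonzero neg)))
  where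
  NegativeSomewhere : Demand → Set
  NegativeSomewhere m = Any (λ x → T (isNegative (m x))) C
  negative-nonzero : ∀ {z} → T (isNegative z) → isZero z ≡ false
  negative-nonzero { -[1+ _ ]} _ = refl

columnCells : ℕ → List Cell
columnCells j = map (λ i → (i , j)) (upTo 4)

cells-suc-↭ : ∀ n → cells (suc n) ↭ cells n ++ columnCells n
cells-suc-↭ n = begin
  cells (suc n)
    ≡⟨ concatMap-cong (λ i → map-upTo-suc (λ j → (i , j)) n) (upTo 4) ⟩
  concatMap (λ i → map (λ j → (i , j)) (upTo n) ++ [ (i , n) ]) (upTo 4)
    ↭⟨ concatMap-++-↭ (λ i → map (λ j → (i , j)) (upTo n)) (λ i → [ (i , n) ]) (upTo 4) ⟩
  cells n ++ columnCells n ∎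
  where open PermutationReasoning

block : ℕ → ℕ → List Placement
block r c = concatMap (λ a → map (place r c a) (upTo 2)) (upTo 2)

columnPlacements : ℕ → List Placement
columnPlacements c = concatMap (λ r → block r c) (upTo 3)

placements-suc-↭ : ∀ n → placements (suc (suc n)) ↭ columnPlacements n ++ placements (suc n)
placements-suc-↭ n = begin
  placements (suc (suc n))
    ≡⟨ concatMap-cong (λ r → concatMap-upTo-suc (block r) n) (upTo 3) ⟩
  concatMap (λ r → concatMap (block r) (upTo n) ++ block r n) (upTo 3)
    ↭⟨ concatMap-++-↭ (λ r → concatMap (block r) (upTo n)) (λ r → block r n) (upTo 3) ⟩
  placements (suc n) ++ columnPlacements n
    ↭⟨ ++-comm (placements (suc n)) (columnPlacements n) ⟩
  columnPlacements n ++ placements (suc n) ∎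
  where open PermutationReasoning

≤ᵇ-false : ∀ {x y} → y < x → (x ≤ᵇ y) ≡ false
≤ᵇ-false {x} {y} y<x with x ≤ᵇ y in eq
... | false = refl
... | true  = ⊥-elim (ℕ.<⇒≱ y<x (ℕ.≤ᵇ⇒≤ x y (subst T (sym eq) tt)))

≤ᵇ-suc : ∀ x y → (suc x ≤ᵇ suc y) ≡ (x ≤ᵇ y)
≤ᵇ-suc zero    y = refl
≤ᵇ-suc (suc x) y = refl

covers-leftOf : ∀ r c a b i {j} → j < c → covers (place r c a b) (i , j) ≡ false
covers-leftOf r c a b i j<c rewrite ≤ᵇ-false j<c
  | ∧-zeroʳ (i ≤ᵇ r ℕ.+ 1) = ∧-zeroʳ (r ≤ᵇ i)

covers-rightOf : ∀ r c a b i {j} → c ℕ.+ 1 < j → covers (place r c a b) (i , j) ≡ false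
covers-rightOf r c a b i {j} c+1<j rewrite ≤ᵇ-false c+1<j
  | ∧-zeroʳ (c ≤ᵇ j) | ∧-zeroʳ (i ≤ᵇ r ℕ.+ 1) = ∧-zeroʳ (r ≤ᵇ i)

translate : ℕ → Placement → Placement
translate n (place r c a b) = place r (c ℕ.+ n) a b

covers-translate : ∀ n p i j → covers (translate n p) (i , j ℕ.+ n) ≡ covers p (i , j)
covers-translate zero    (place r c a b) i j rewrite ℕ.+-identityʳ c | ℕ.+-identityʳ j = refl
covers-translate (suc n) (place r c a b) i j rewrite ℕ.+-suc c n | ℕ.+-suc j n
  | ≤ᵇ-suc (c ℕ.+ n) (j ℕ.+ n) | ≤ᵇ-suc (j ℕ.+ n) (c ℕ.+ n ℕ.+ 1) = covers-translate n (place r c a b) i j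

block-all : ∀ {P : Placement → Set} r c → (∀ a b → P (place r c a b)) → All P (block r c)
block-all r c h = concat⁺ (map⁺ (All.universal (λ a → map⁺ (All.universal (h a) (upTo 2))) (upTo 2)))

columnPlacements-all : ∀ {P : Placement → Set} n → (∀ r a b → P (place r n a b)) → All P (columnPlacements n)
columnPlacements-all n h = concat⁺ (map⁺ (All.universal (λ r → block-all r n (h r)) (upTo 3)))

placements-all : ∀ {P : Placement → Set} n → (∀ r c a b → c < n → P (place r c a b)) → All P (placements (suc n))
placements-all {P} n h = concat⁺ (map⁺ (All.universal (λ r → concat⁺ (map⁺
  (applyUpTo⁺₁ {P = All P ∘ block r} (λ c → c) n (λ {c} c<n → block-all r c (λ a b → h r c a b c<n))))) (upTo 3)))

placements-untouched : ∀ n → All (Untouched (columnCells (suc n))) (placements (suc n))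
placements-untouched n = placements-all n (λ r c a b c<n →
  map⁺ (All.universal (λ i → covers-rightOf r c a b i (s≤s (subst (ℕ._≤ n) (ℕ.+-comm 1 c) c<n))) (upTo 4)))

-- The transfer operator

rows : Vec ℕ 4
rows = 0 ∷ 1 ∷ 2 ∷ 3 ∷ []

column : Demand → ℕ → Vec ℤ 4
column m j = mapᵛ (λ i → m (i , j)) rows

coverageColumn : Placement → ℕ → Vec ℕ 4
coverageColumn p j = mapᵛ (λ i → coverage p (i , j)) rows

_⊖_ : ∀ {n} → Vec ℤ n → Vec ℕ n → Vec ℤ n
w ⊖ v = zipWith (λ z k → z - + k) w v

-- The residual demands of the current and of the next column.
State : Set
State = Vec ℤ 4 × Vec ℤ 4

Profile : Set
Profile = Vec ℕ 4 × Vec ℕ 4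

_⊖²_ : State → Profile → State
(w , w′) ⊖² (v , v′) = w ⊖ v , w′ ⊖ v′

profile : ℕ → Placement → Profile
profile j p = coverageColumn p j , coverageColumn p (suc j)

columnProfiles : List Profile
columnProfiles = map (profile 0) (columnPlacements 0)

profile-translate : ∀ n p → profile n (translate n p) ≡ profile 0 p
profile-translate n p = cong₂ _,_ (Vec.map-cong (λ i → cong 0or1 (covers-translate n p i 0)) rows)
                                  (Vec.map-cong (λ i → cong 0or1 (covers-translate n p i 1)) rows)
  where
  0or1 : Bool → ℕ
  0or1 b = if b then 1 else 0

columnProfiles-translate : ∀ n → map (profile n) (columnPlacements n) ≡ columnProfiles
columnProfiles-translate n = trans (sym (map-∘ {g = profile n} {f = translate n} (columnPlacements 0)))
                                   (map-cong (profile-translate n) (columnPlacements 0))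

bit? : ℤ → Maybe Bool
bit? (+ zero)        = just false
bit? (+ suc zero)    = just true
bit? (+ suc (suc _)) = nothing
bit? -[1+ _ ]        = nothing

bits? : ∀ {n} → Vec ℤ n → Maybe (Vec Bool n)
bits? []      = just []
bits? (z ∷ w) = Maybe.zipWith _∷_ (bit? z) (bits? w)

bit?-just : ∀ z {c} → bit? z ≡ just c → z ≡ indicator c
bit?-just (+ zero)     refl = refl
bit?-just (+ suc zero) refl = refl

bits?-just : ∀ {n} (w : Vec ℤ n) {b} → bits? w ≡ just b → w ≡ mapᵛ indicator b
bits?-just []      refl = refl
bits?-just (z ∷ w) e with bit? z in ez | bits? w in ew
bits?-just (z ∷ w) refl | just c  | just b = cong₂ _∷_ (bit?-just z ez) (bits?-just w ew)

anyNegative : ∀ {n} → Vec ℤ n → Bool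
anyNegative []      = false
anyNegative (z ∷ w) = isNegative z ∨ anyNegative w

bits?-nothing : ∀ {n} (w : Vec ℤ n) → Allᵛ (ℤ._≤ + 1) w → bits? w ≡ nothing → Anyᵛ (T ∘ isNegative) w
bits?-nothing (-[1+ _ ] ∷ w)          _           _ = Anyᵛ.here tt
bits?-nothing (+ suc (suc _) ∷ w)     (ℤ.+≤+ (s≤s ()) Allᵛ.∷ _) _
bits?-nothing (+ zero ∷ w)            (_ Allᵛ.∷ ≤1) e with bits? w in ew
... | nothing = Anyᵛ.there (bits?-nothing w ≤1 ew)
bits?-nothing (+ suc zero ∷ w)        (_ Allᵛ.∷ ≤1) e with bits? w in ew
... | nothing = Anyᵛ.there (bits?-nothing w ≤1 ew)

bits?-anyNegative : ∀ {n} (w : Vec ℤ n) → T (anyNegative w) → bits? w ≡ nothing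
bits?-anyNegative (-[1+ _ ] ∷ w) _ = refl
bits?-anyNegative (+ k ∷ w)      h rewrite bits?-anyNegative w h = zipWith-nothing (bit? (+ k))
  where
  zipWith-nothing : ∀ (x : Maybe Bool) → Maybe.zipWith _∷_ x nothing ≡ nothing
  zipWith-nothing (just _) = refl
  zipWith-nothing nothing  = refl

anyNegative-⊖ : ∀ {n} (w : Vec ℤ n) v → T (anyNegative w) → T (anyNegative (w ⊖ v))
anyNegative-⊖ (z ∷ w) (k ∷ v) h with isNegative z in ez
... | true  = Equivalence.from T-∨ (inj₁ (isNegative-minus z k (subst T (sym ez) tt)))
... | false = Equivalence.from T-∨ (inj₂ (anyNegative-⊖ w v h))

allZero : ∀ {n} → Vec ℤ n → Bool
allZero []      = true
allZero (z ∷ w) = isZero z ∧ allZero w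

allZero-anyNegative : ∀ {n} (w : Vec ℤ n) → T (anyNegative w) → allZero w ≡ false
allZero-anyNegative (-[1+ _ ] ∷ w) _ = refl
allZero-anyNegative (+ k ∷ w)      h rewrite allZero-anyNegative w h = ∧-zeroʳ (isZero (+ k))

extend : ∀ {n} → (Vec Bool n → ℤ) → Vec ℤ n → ℤ
extend v w = maybe′ v (+ 0) (bits? w)

extend-cong : ∀ {n} {v v′ : Vec Bool n → ℤ} → v ≗ v′ → ∀ w → extend v w ≡ extend v′ w
extend-cong v≗v′ w with bits? w
... | just b  = v≗v′ b
... | nothing = refl

extend-+ : ∀ {n} (v v′ : Vec Bool n → ℤ) w → extend (λ b → v b + v′ b) w ≡ extend v w + extend v′ w
extend-+ v v′ w with bits? w
... | just b  = refl
... | nothing = refl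

extend-* : ∀ {n} c (v : Vec Bool n → ℤ) w → extend (λ b → c * v b) w ≡ c * extend v w
extend-* c v w with bits? w
... | just b  = refl
... | nothing = sym (ℤ.*-zeroʳ c)

transferLeaf : (Vec Bool 4 → ℤ) → State → ℤ
transferLeaf v (w , w′) = extend v w * indicator (allZero w′)

initialState : Vec Bool 4 → State
initialState u = replicate 4 (+ 1) , mapᵛ indicator u

-- Residual demands only decrease, so a state with a negative entry contributes nothing.
dead : State → Bool
dead (w , w′) = anyNegative w ∨ anyNegative w′

prunedTransfer : (Vec Bool 4 → ℤ) → Vec Bool 4 → ℤ
prunedTransfer v u = prunedSum _⊖²_ dead columnProfiles (transferLeaf v) (initialState u)

-- A set of trominoes with left column 0 contributes v b when it leaves the 0/1 pattern b of column 0
-- uncovered and covers exactly the cells of column 1 marked by u. The sum has 2¹² terms, so transfer is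
-- opaque: the typechecker must never unfold it, and evaluation goes through prunedTransfer.
opaque
  transfer : (Vec Bool 4 → ℤ) → Vec Bool 4 → ℤ
  transfer v u = sublistSum _⊖²_ columnProfiles (transferLeaf v) (initialState u)

  transfer-unfold : ∀ v u → transfer v u ≡ sublistSum _⊖²_ columnProfiles (transferLeaf v) (initialState u)
  transfer-unfold v u = refl

  transfer-isLinear : IsLinear transfer
  IsLinear.cong-≗ transfer-isLinear v≗v′ u =
    sublistSum-cong _⊖²_ columnProfiles (λ { (w , w′) → cong (_* indicator (allZero w′)) (extend-cong v≗v′ w) }) (initialState u)
  IsLinear.+-homo transfer-isLinear v v′ u = trans
    (sublistSum-cong _⊖²_ columnProfiles leaf-+ (initialState u))
    (sublistSum-+ _⊖²_ columnProfiles (transferLeaf v) (transferLeaf v′) (initialState u))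
    where
    leaf-+ : ∀ s → transferLeaf (λ b → v b + v′ b) s ≡ transferLeaf v s + transferLeaf v′ s
    leaf-+ (w , w′) = trans (cong (_* indicator (allZero w′)) (extend-+ v v′ w))
                            (ℤ.*-distribʳ-+ (indicator (allZero w′)) (extend v w) (extend v′ w))
  IsLinear.*-homo transfer-isLinear c v u = trans
    (sublistSum-cong _⊖²_ columnProfiles leaf-* (initialState u))
    (sublistSum-*ˡ _⊖²_ columnProfiles c (transferLeaf v) (initialState u))
    where
    leaf-* : ∀ s → transferLeaf (λ b → c * v b) s ≡ c * transferLeaf v s
    leaf-* (w , w′) = trans (cong (_* indicator (allZero w′)) (extend-* c v w))
                            (ℤ.*-assoc c (extend v w) (indicator (allZero w′)))

  transfer≡prunedTransfer : ∀ v u → transfer v u ≡ prunedTransfer v u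
  transfer≡prunedTransfer v u =
    sublistSum≡prunedSum _⊖²_ dead (λ {s} → dead-⊖² s) columnProfiles (transferLeaf v) (λ {s} → leaf-dead s) (initialState u)
    where
    dead-⊖² : ∀ s q → T (dead s) → T (dead (s ⊖² q))
    dead-⊖² (w , w′) (v , v′) h with Equivalence.to T-∨ h
    ... | inj₁ hw  = Equivalence.from T-∨ (inj₁ (anyNegative-⊖ w v hw))
    ... | inj₂ hw′ = Equivalence.from T-∨ (inj₂ (anyNegative-⊖ w′ v′ hw′))
    leaf-dead : ∀ s → T (dead s) → transferLeaf v s ≡ + 0
    leaf-dead (w , w′) h with Equivalence.to T-∨ h
    ... | inj₁ hw  = cong (λ x → maybe′ v (+ 0) x * indicator (allZero w′)) (bits?-anyNegative w hw)
    ... | inj₂ hw′ = trans (cong (λ b → extend v w * indicator b) (allZero-anyNegative w′ hw′)) (ℤ.*-zeroʳ (extend v w))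

-- Counting column by column

-- The f_n of the proof idea: tilings of columns 0 … n − 1 and of the cells of column n marked by b.
frontierCount : ℕ → Vec Bool 4 → ℤ
frontierCount zero    b = indicator (allZero (mapᵛ indicator b))
frontierCount (suc n) = transfer (frontierCount n)

Filled : ℕ → Demand → Set
Filled n m = ∀ i j → j < n → m (i , j) ≡ + 1

record Tracks (n : ℕ) (m : Demand) (s : State) : Set where
  field
    filled    : Filled n m
    current   : column m n ≡ proj₁ s
    next      : column m (suc n) ≡ proj₂ s
    atMostOne : Allᵛ (ℤ._≤ + 1) (proj₁ s)

⊖-≤ : ∀ {n c} (w : Vec ℤ n) v → Allᵛ (ℤ._≤ c) w → Allᵛ (ℤ._≤ c) (w ⊖ v)
⊖-≤ []      []      Allᵛ.[]           = Allᵛ.[]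
⊖-≤ (z ∷ w) (k ∷ v) (z≤c Allᵛ.∷ w≤c) = ℤ.i≤j⇒i-k≤j (+ k) z≤c Allᵛ.∷ ⊖-≤ w v w≤c

tracks-∖ : ∀ n r a b {m s} → Tracks n m s → Tracks n (m ∖ place r n a b) (s ⊖² profile n (place r n a b))
tracks-∖ n r a b {m} {w , w′} t = record
  { filled    = filled′
  ; current   = cong (_⊖ coverageColumn (place r n a b) n) (Tracks.current t)
  ; next      = cong (_⊖ coverageColumn (place r n a b) (suc n)) (Tracks.next t)
  ; atMostOne = ⊖-≤ w (coverageColumn (place r n a b) n) (Tracks.atMostOne t)
  }
  where
  filled′ : Filled n (m ∖ place r n a b)
  filled′ i j j<n rewrite covers-leftOf r n a b i j<n = trans (ℤ.+-identityʳ (m (i , j))) (Tracks.filled t i j j<n)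

CountsFrontier : ℕ → Set
CountsFrontier n = ∀ {m} b → Filled n m → column m n ≡ mapᵛ indicator b →
  exactCovers (placements (suc n)) (cells (suc n)) m ≡ frontierCount n b

exactCovers-extend : ∀ n → CountsFrontier n → ∀ {m} → Filled n m → Allᵛ (ℤ._≤ + 1) (column m n) →
  exactCovers (placements (suc n)) (cells (suc n)) m ≡ extend (frontierCount n) (column m n)
exactCovers-extend n counts {m} filled ≤1 with bits? (column m n) in eq
... | just b  = counts b filled (bits?-just (column m n) eq)
... | nothing = exactCovers-negative (placements (suc n)) (cells (suc n)) m negative-cell
  where
  negative-cell : Any (λ x → T (isNegative (m x))) (cells (suc n))
  negative-cell = Any-resp-↭ (↭-sym (cells-suc-↭ n)) (Any.++⁺ʳ (cells n)
    (Any.map⁺ {f = λ i → (i , n)} (Anyᵛ.toList⁺ (Anyᵛ.map⁻ {f = λ i → m (i , n)} {xs = rows}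
      (bits?-nothing (column m n) ≤1 eq)))))

exactCovers-transferLeaf : ∀ n → CountsFrontier n → ∀ m s → Tracks n m s →
  exactCovers (placements (suc n)) (cells (suc n) ++ columnCells (suc n)) m ≡ transferLeaf (frontierCount n) s
exactCovers-transferLeaf n counts m (w , w′) t = begin
  exactCovers (placements (suc n)) (cells (suc n) ++ columnCells (suc n)) m
    ≡⟨ exactCovers-untouched (placements (suc n)) (cells (suc n)) (columnCells (suc n)) (placements-untouched n) m ⟩
  exactCovers (placements (suc n)) (cells (suc n)) m * indicator (allZero (column m (suc n)))
    ≡⟨ cong (_* indicator (allZero (column m (suc n))))
            (exactCovers-extend n counts (Tracks.filled t)
                                (subst (Allᵛ (ℤ._≤ + 1)) (sym (Tracks.current t)) (Tracks.atMostOne t))) ⟩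
  extend (frontierCount n) (column m n) * indicator (allZero (column m (suc n)))
    ≡⟨ cong₂ (λ w w′ → extend (frontierCount n) w * indicator (allZero w′)) (Tracks.current t) (Tracks.next t) ⟩
  transferLeaf (frontierCount n) (w , w′) ∎
  where open ≡-Reasoning

exactCovers-frontier : ∀ n → CountsFrontier n
exactCovers-frontier zero    b filled eq = cong (indicator ∘ allZero) eq
exactCovers-frontier (suc n) {m} b filled eq = begin
  exactCovers (placements (suc (suc n))) (cells (suc (suc n))) m
    ≡⟨ exactCovers-↭ (cells (suc (suc n))) (placements-suc-↭ n) m ⟩
  exactCovers (columnPlacements n ++ placements (suc n)) (cells (suc (suc n))) m
    ≡⟨ exactCovers-cells-↭ (columnPlacements n ++ placements (suc n)) (cells-suc-↭ (suc n)) m ⟩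
  exactCovers (columnPlacements n ++ placements (suc n)) (cells (suc n) ++ columnCells (suc n)) m
    ≡⟨ sublistSum-++ _∖_ (columnPlacements n) (placements (suc n)) (indicator ∘ zeroOn (cells (suc n) ++ columnCells (suc n))) m ⟩
  sublistSum _∖_ (columnPlacements n) rest m
    ≡⟨ sublistSum-simulation {act = _∖_} {act′ = _⊖²_} (Tracks n) (profile n) {k = rest} {k′ = transferLeaf (frontierCount n)}
         (columnPlacements n) (columnPlacements-all n (tracks-∖ n))
         (λ {m′} {s} → exactCovers-transferLeaf n (exactCovers-frontier n) m′ s) start ⟩
  sublistSum _⊖²_ (map (profile n) (columnPlacements n)) (transferLeaf (frontierCount n)) (column m n , column m (suc n))
    ≡⟨ cong₂ (λ ps s → sublistSum _⊖²_ ps (transferLeaf (frontierCount n)) s) (columnProfiles-translate n) start-state ⟩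
  sublistSum _⊖²_ columnProfiles (transferLeaf (frontierCount n)) (initialState b)
    ≡⟨ transfer-unfold (frontierCount n) b ⟨
  transfer (frontierCount n) b ∎
  where
  open ≡-Reasoning
  rest : Demand → ℤ
  rest = exactCovers (placements (suc n)) (cells (suc n) ++ columnCells (suc n))
  ones : column m n ≡ replicate 4 (+ 1)
  ones = Vec.map-cong (λ i → filled i n (ℕ.n<1+n n)) rows
  start-state : (column m n , column m (suc n)) ≡ initialState b
  start-state = cong₂ _,_ ones eq
  start : Tracks n m (column m n , column m (suc n))
  start = record
    { filled    = λ i j j<n → filled i j (ℕ.m<n⇒m<1+n j<n)
    ; current   = refl
    ; next      = refl
    ; atMostOne = subst (Allᵛ (ℤ._≤ + 1)) (sym ones) (ℤ.≤-refl Allᵛ.∷ ℤ.≤-refl Allᵛ.∷ ℤ.≤-refl Allᵛ.∷ ℤ.≤-refl Allᵛ.∷ Allᵛ.[])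
    }

-- Passing the previous table as an argument lets evaluation share it across all lookups.
transferTable : Table 4 → Table 4
transferTable t = tabulateᵀ (prunedTransfer (lookupᵀ t))

frontierTable : ℕ → Table 4
frontierTable zero    = tabulateᵀ (frontierCount 0)
frontierTable (suc n) = transferTable (frontierTable n)

frontierCount≗table : ∀ n → frontierCount n ≗ lookupᵀ (frontierTable n)
frontierCount≗table zero    b = sym (lookup-tabulateᵀ (frontierCount 0) b)
frontierCount≗table (suc n) b = begin
  transfer (frontierCount n) b                  ≡⟨ IsLinear.cong-≗ transfer-isLinear (frontierCount≗table n) b ⟩
  transfer (lookupᵀ (frontierTable n)) b        ≡⟨ transfer≡prunedTransfer (lookupᵀ (frontierTable n)) b ⟩
  prunedTransfer (lookupᵀ (frontierTable n)) b  ≡⟨ lookup-tabulateᵀ (prunedTransfer (lookupᵀ (frontierTable n))) b ⟨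
  lookupᵀ (frontierTable (suc n)) b             ∎
  where open ≡-Reasoning

-- The recurrence

-- The coefficients of 1 − 10z + 22z² + 4z³, at offsets counted in columns: one unit of t is three columns.
recurrence : List (ℤ × ℕ)
recurrence = (+ 1 , 9) ∷ (- (+ 10) , 6) ∷ (+ 22 , 3) ∷ (+ 4 , 0) ∷ []

frontier-recurrence : ∀ j → shiftedSum recurrence frontierCount j ≗ λ _ → + 0
frontier-recurrence = shiftedSum-vanishes transfer-isLinear {F = frontierCount} (λ k u → refl) recurrence initial
  where
  initial : shiftedSum recurrence frontierCount 0 ≗ λ _ → + 0
  initial u = trans (shiftedSum-cong recurrence frontierCount≗table 0 u)
                    (≗-from-tabulateᵀ {f = shiftedSum recurrence (lookupᵀ ∘ frontierTable) 0} {g = λ _ → + 0} refl u)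

full : Vec Bool 4
full = replicate 4 true

N-frontier : ∀ d s → N (suc (d ℕ.+ s)) ≡ frontierCount (3 ℕ.* d ℕ.+ (3 ℕ.* s ℕ.+ 2)) full
N-frontier d s = begin
  + tilings (3 ℕ.* suc (d ℕ.+ s))                              ≡⟨ cong (+_ ∘ tilings) (width d s) ⟩
  + tilings (suc k)                                            ≡⟨ tilings-exactCovers (suc k) ⟩
  exactCovers (placements (suc k)) (cells (suc k)) (λ _ → + 1)  ≡⟨ exactCovers-frontier k full (λ _ _ _ → refl) refl ⟩
  frontierCount k full                                         ∎
  where
  open ≡-Reasoning
  k = 3 ℕ.* d ℕ.+ (3 ℕ.* s ℕ.+ 2)
  width : ∀ d s → 3 ℕ.* suc (d ℕ.+ s) ≡ suc (3 ℕ.* d ℕ.+ (3 ℕ.* s ℕ.+ 2))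
  width = ℕ-Solver.solve-∀

N-shiftedSum : ∀ s → polyMul (+ 1 ∷ - (+ 10) ∷ + 22 ∷ + 4 ∷ []) N (suc (suc (suc (suc s))))
                   ≡ shiftedSum recurrence frontierCount (3 ℕ.* s ℕ.+ 2) full
N-shiftedSum s =
  cong₂ _+_ (cong (+ 1 *_) (N-frontier 3 s)) (cong₂ _+_ (cong (- (+ 10) *_) (N-frontier 2 s))
  (cong₂ _+_ (cong (+ 22 *_) (N-frontier 1 s)) (cong₂ _+_ (cong (+ 4 *_) (N-frontier 0 s)) refl)))

-- N t itself must never be evaluated (it enumerates all sets of placements): Nᵀ reads it off the tables.
Nᵀ : ℕ → ℤ
Nᵀ zero    = + 1
Nᵀ (suc s) = lookupᵀ (frontierTable (3 ℕ.* s ℕ.+ 2)) full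

N≗Nᵀ : N ≗ Nᵀ
N≗Nᵀ zero    = refl
N≗Nᵀ (suc s) = trans (N-frontier 0 s) (frontierCount≗table (3 ℕ.* s ℕ.+ 2) full)

polyMul-cong : ∀ cs {f g : ℕ → ℤ} → f ≗ g → polyMul cs f ≗ polyMul cs g
polyMul-cong []       f≗g n       = refl
polyMul-cong (c ∷ cs) f≗g zero    = cong (c *_) (f≗g 0)
polyMul-cong (c ∷ cs) f≗g (suc n) = cong₂ _+_ (cong (c *_) (f≗g (suc n))) (polyMul-cong cs f≗g n)

polyMul-N≗Nᵀ : polyMul (+ 1 ∷ - (+ 10) ∷ + 22 ∷ + 4 ∷ []) N ≗ polyMul (+ 1 ∷ - (+ 10) ∷ + 22 ∷ + 4 ∷ []) Nᵀ
polyMul-N≗Nᵀ = polyMul-cong (+ 1 ∷ - (+ 10) ∷ + 22 ∷ + 4 ∷ []) {f = N} {g = Nᵀ} N≗Nᵀ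

mainTheorem1 : (t : ℕ) →
    polyMul (+ 1 ∷ - (+ 10) ∷ + 22 ∷ + 4 ∷ []) N t ≡ coeff (+ 1 ∷ - (+ 6) ∷ []) t
-- The pattern t@k keeps the goal syntactically equal to the argument, so Agda does not evaluate N k.
mainTheorem1 t@0 = polyMul-N≗Nᵀ t
mainTheorem1 t@1 = polyMul-N≗Nᵀ t
mainTheorem1 t@2 = polyMul-N≗Nᵀ t
mainTheorem1 t@3 = polyMul-N≗Nᵀ t
mainTheorem1 (suc (suc (suc (suc s)))) = trans (N-shiftedSum s) (frontier-recurrence (3 ℕ.* s ℕ.+ 2) full)
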